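{- A class of graphs has bounded treedepth if and only if it is distance-$\infty$ deletion-flat.
   Context: A class $\mathcal{C}$ is distance-$\infty$ deletion-flat if there exist a function $N:\mathbb{N}\to\mathbb{N}$ and a constant $k$ such that for all $m\in\mathbb{N}$, $G\in\mathcal{C}$ and $W\subseteq V(G)$ with $|W|\ge N(m)$ there exist a set $S\subseteq V(G)$ with $|S|\le k$ and a subset $W_\star\subseteq W\setminus S$ with $|W_\star|\ge m$ such that no two distinct vertices of $W_\star$ lie in the same connected component of $G-S$. Treedepth is the standard graph parameter. -}

module Defs where

open import Data.Nat using (ℕ; zero; suc; _≤_; _≥_)
open import Data.Fin using (Fin)
open import Data.Fin.Subset using (Subset; _∈_; _∉_; _⊆_; ∣_∣)
open import Data.Bool using (Bool; true; false)
open import Data.Maybe using (Maybe; just; nothing)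
open import Data.Product using (Σ; ∃; _×_; _,_)
open import Relation.Binary.PropositionalEquality using (_≡_; _≢_)
open import Relation.Nullary using (¬_)

record Graph : Set where
  field
    n     : ℕ
    adj   : Fin n → Fin n → Bool
    sym   : ∀ u v → adj u v ≡ adj v u
    irrefl : ∀ v → adj v v ≡ false

open Graph public

GraphClass : Set₁
GraphClass = Graph → Set

record RootedForest (n : ℕ) : Set where
  field
    parent : Fin n → Maybe (Fin n)
    depth  : Fin n → ℕ
    depth-root  : ∀ v → parent v ≡ nothing → depth v ≡ 1
    depth-child : ∀ v u → parent v ≡ just u → depth v ≡ suc (depth u)

open RootedForest public

data AncEq {n : ℕ} (F : RootedForest n) : Fin n → Fin n → Set where
  anc-refl : ∀ v → AncEq F v v
  anc-step : ∀ {u w} v → parent F v ≡ just w → AncEq F u w → AncEq F u v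

TreedepthAtMost : Graph → ℕ → Set
TreedepthAtMost G d =
  Σ (RootedForest (n G)) λ F →
      (∀ v → depth F v ≤ d)
    × (∀ u v → adj G u v ≡ true → AncEq F u v Data.Sum.⊎ AncEq F v u)
  where import Data.Sum

BoundedTreedepth : GraphClass → Set
BoundedTreedepth C = ∃ λ d → ∀ G → C G → TreedepthAtMost G d

data SameComponent (G : Graph) (S : Subset (n G)) : Fin (n G) → Fin (n G) → Set where
  here : ∀ {u} → u ∉ S → SameComponent G S u u
  step : ∀ {u w v} → u ∉ S → adj G u w ≡ true → SameComponent G S w v →
         SameComponent G S u v

DistInfDeletionFlat : GraphClass → Set
DistInfDeletionFlat C =
  Σ (ℕ → ℕ) λ N → Σ ℕ λ k →
    ∀ (m : ℕ) (G : Graph) → C G → (W : Subset (n G)) → ∣ W ∣ ≥ N m →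
      Σ (Subset (n G)) λ S → ∣ S ∣ ≤ k ×
        Σ (Subset (n G)) λ W⋆ →
            W⋆ ⊆ W
          × (∀ {v} → v ∈ W⋆ → v ∉ S)
          × ∣ W⋆ ∣ ≥ m
          × (∀ {u v} → u ∈ W⋆ → v ∈ W⋆ → u ≢ v → ¬ SameComponent G S u v)

{-# OPTIONS --safe #-}
module Submission where

-- If G has an elimination forest of depth d, peel W from the top.  Let S hold the common
-- ancestors of W of depth ≤ j.  Either m vertices of W lie in distinct subtrees rooted at
-- depth j + 1, which are unions of components of G − S, or one such subtree holds many
-- vertices of W and its root joins S.  The second case can happen at most d times.
--
-- Conversely, a path on N(k + 2) vertices is not flat: deleting k vertices cuts it into at
-- most k + 1 segments, each inside one component, so at most k + 1 of its vertices are
-- pairwise separated.  So every path in the class has fewer than N(k + 2) vertices, and a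
-- depth-first search forest, in which every edge joins an ancestor to a descendant and
-- every chain from the root is a path, has at most that depth.

open import Defs hiding (sym)

open import Data.Nat using (ℕ; zero; suc; _+_; _*_; _∸_; _≤_; _<_; _≥_; z≤n; s≤s; _≤?_; _<?_)
open import Data.Nat.Properties hiding (_≟_)
open import Data.Fin using (Fin)
open import Data.Fin.Properties using (_≟_)
open import Data.Fin.Subset using (Subset; ⊤; _∈_; _∉_; _⊆_; ∣_∣; ⊥; ⁅_⁆; _∪_; _∩_; _-_; _─_; inside; outside; Nonempty)
open import Data.Fin.Subset.Properties
  using (p⊆q⇒∣p∣≤∣q∣; ∈⊤; ∣⊤∣≡n; ∣⊥∣≡0; ∉⊥; ⊥⊆; nonempty?; Empty-unique; x∈p∪q⁻; x∈p∪q⁺; p⊆p∪q; x∈⁅x⁆; x∈⁅y⁆⇒x≡y; ∣⁅x⁆∣≡1;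
         x∈p∩q⁺; x∈p∩q⁻; x∈p∧x∉q⇒x∈p─q; x∈p∧x≢y⇒x∈p-y; x∈p⇒∣p-x∣<∣p∣; p─q⊆p; p⊂q⇒∣p∣<∣q∣; _∈?_)
open import Data.Bool using (true; false)
open import Data.Maybe using (Maybe; just; nothing)
open import Data.Product using (Σ; ∃; _×_; _,_; proj₁; proj₂)
open import Data.Sum using (_⊎_; inj₁; inj₂; [_,_]′)
open import Data.Unit using (tt) renaming (⊤ to Unit)
open import Data.Empty using () renaming (⊥ to Empty)
open import Data.Vec using ([]; _∷_; here; there; tabulate)
open import Data.Vec.Properties using (lookup∘tabulate; []=⇒lookup; lookup⇒[]=)
open import Data.Vec.Functional using (updateAt)
open import Data.Vec.Functional.Properties using (updateAt-updates; updateAt-minimal)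
open import Data.List using (List; []; _∷_; length; allFin)
open import Data.List.Membership.Propositional using () renaming (_∈_ to _∈ₗ_)
open import Data.List.Membership.Propositional.Properties using (∈-allFin)
open import Data.List.Relation.Unary.Any using (here; there)
open import Data.List.Relation.Unary.All as All using (All; []; _∷_)
open import Data.List.Relation.Unary.Linked using (Linked; []; [-]; _∷_) renaming (tail to Linked-tail)
open import Data.List.Relation.Unary.Unique.Propositional using (Unique; []; _∷_)
open import Function using (_∘_; const; id)
open import Function.Bundles using (_⇔_; mk⇔)
open import Relation.Binary.Definitions using (DecidableEquality)
open import Relation.Binary.PropositionalEquality using (_≡_; _≢_; refl; sym; trans; cong; subst; module ≡-Reasoning)
open import Relation.Nullary using (¬_; yes; no; does; contradiction)
open import Relation.Nullary.Decidable using (dec-true)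

-- Subsets and fibres

∣p∪q∣≤∣p∣+∣q∣ : ∀ {n} (p q : Subset n) → ∣ p ∪ q ∣ ≤ ∣ p ∣ + ∣ q ∣
∣p∪q∣≤∣p∣+∣q∣ []            []            = z≤n
∣p∪q∣≤∣p∣+∣q∣ (outside ∷ p) (outside ∷ q) = ∣p∪q∣≤∣p∣+∣q∣ p q
∣p∪q∣≤∣p∣+∣q∣ (inside  ∷ p) (outside ∷ q) = s≤s (∣p∪q∣≤∣p∣+∣q∣ p q)
∣p∪q∣≤∣p∣+∣q∣ (outside ∷ p) (inside  ∷ q) =
  ≤-trans (s≤s (∣p∪q∣≤∣p∣+∣q∣ p q)) (≤-reflexive (sym (+-suc ∣ p ∣ ∣ q ∣)))
∣p∪q∣≤∣p∣+∣q∣ (inside  ∷ p) (inside  ∷ q) =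
  s≤s (≤-trans (∣p∪q∣≤∣p∣+∣q∣ p q) (+-monoʳ-≤ ∣ p ∣ (n≤1+n ∣ q ∣)))

∣p∣≤∣p─q∣+∣q∣ : ∀ {n} (p q : Subset n) → ∣ p ∣ ≤ ∣ p ─ q ∣ + ∣ q ∣
∣p∣≤∣p─q∣+∣q∣ p q = ≤-trans (p⊆q⇒∣p∣≤∣q∣ p⊆[p─q]∪q) (∣p∪q∣≤∣p∣+∣q∣ (p ─ q) q)
  where
  p⊆[p─q]∪q : p ⊆ (p ─ q) ∪ q
  p⊆[p─q]∪q {x} x∈p with x ∈? q
  ... | yes x∈q = x∈p∪q⁺ (inj₂ x∈q)
  ... | no  x∉q = x∈p∪q⁺ (inj₁ (x∈p∧x∉q⇒x∈p─q x∈p x∉q))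

∣p∣≤1+∣p-x∣ : ∀ {n} (p : Subset n) (x : Fin n) → ∣ p ∣ ≤ suc ∣ p - x ∣
∣p∣≤1+∣p-x∣ p x = begin
  ∣ p ∣                 ≤⟨ ∣p∣≤∣p─q∣+∣q∣ p ⁅ x ⁆ ⟩
  ∣ p - x ∣ + ∣ ⁅ x ⁆ ∣ ≡⟨ cong (∣ p - x ∣ +_) (∣⁅x⁆∣≡1 x) ⟩
  ∣ p - x ∣ + 1         ≡⟨ +-comm _ 1 ⟩
  suc ∣ p - x ∣         ∎
  where open ≤-Reasoning

∣p∪⁅x⁆∣≤1+∣p∣ : ∀ {n} (p : Subset n) (x : Fin n) → ∣ p ∪ ⁅ x ⁆ ∣ ≤ suc ∣ p ∣
∣p∪⁅x⁆∣≤1+∣p∣ p x = begin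
  ∣ p ∪ ⁅ x ⁆ ∣     ≤⟨ ∣p∪q∣≤∣p∣+∣q∣ p ⁅ x ⁆ ⟩
  ∣ p ∣ + ∣ ⁅ x ⁆ ∣ ≡⟨ cong (∣ p ∣ +_) (∣⁅x⁆∣≡1 x) ⟩
  ∣ p ∣ + 1         ≡⟨ +-comm ∣ p ∣ 1 ⟩
  suc ∣ p ∣         ∎
  where open ≤-Reasoning

∣p∣≥k+x∧∣q∣≤k⇒∣p─q∣≥x : ∀ {n k x} (p q : Subset n) → k + x ≤ ∣ p ∣ → ∣ q ∣ ≤ k → x ≤ ∣ p ─ q ∣
∣p∣≥k+x∧∣q∣≤k⇒∣p─q∣≥x {k = k} {x} p q k+x≤∣p∣ ∣q∣≤k = +-cancelˡ-≤ k x ∣ p ─ q ∣ (begin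
  k + x             ≤⟨ k+x≤∣p∣ ⟩
  ∣ p ∣             ≤⟨ ∣p∣≤∣p─q∣+∣q∣ p q ⟩
  ∣ p ─ q ∣ + ∣ q ∣ ≤⟨ +-monoʳ-≤ ∣ p ─ q ∣ ∣q∣≤k ⟩
  ∣ p ─ q ∣ + k     ≡⟨ +-comm ∣ p ─ q ∣ k ⟩
  k + ∣ p ─ q ∣     ∎)
  where open ≤-Reasoning

x∈p─q⇒x∉q : ∀ {n} {x : Fin n} (p q : Subset n) → x ∈ p ─ q → x ∉ q
x∈p─q⇒x∉q (_ ∷ p) (inside  ∷ q) ()            here
x∈p─q⇒x∉q (_ ∷ p) (inside  ∷ q) (there x∈p─q) (there x∈q) = x∈p─q⇒x∉q p q x∈p─q x∈q
x∈p─q⇒x∉q (_ ∷ p) (outside ∷ q) (there x∈p─q) (there x∈q) = x∈p─q⇒x∉q p q x∈p─q x∈q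

∣p∣>0⇒Nonempty : ∀ {n} {p : Subset n} → 0 < ∣ p ∣ → Nonempty p
∣p∣>0⇒Nonempty {n} {p} 0<∣p∣ with nonempty? p
... | yes p≢∅ = p≢∅
... | no  p≡∅ = contradiction (trans (cong ∣_∣ (Empty-unique p≡∅)) (∣⊥∣≡0 n)) (>⇒≢ 0<∣p∣)

module Fibres {a} {A : Set a} (_≟ᴬ_ : DecidableEquality A) {n : ℕ} (f : Fin n → A) where

  fibre : A → Subset n → Subset n
  fibre c W = W ∩ tabulate (λ x → does (f x ≟ᴬ c))

  ∈-fibre⁺ : ∀ {c W x} → x ∈ W → f x ≡ c → x ∈ fibre c W
  ∈-fibre⁺ {c} {x = x} x∈W fx≡c =
    x∈p∩q⁺ (x∈W , lookup⇒[]= x _ (trans (lookup∘tabulate _ x) (dec-true (f x ≟ᴬ c) fx≡c)))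

  ∈-fibre⁻ : ∀ {c W x} → x ∈ fibre c W → x ∈ W × f x ≡ c
  ∈-fibre⁻ {c} {W} {x} x∈fibre with x∈p∩q⁻ W _ x∈fibre
  ... | x∈W , x∈tab with f x ≟ᴬ c | trans (sym (lookup∘tabulate _ x)) ([]=⇒lookup x∈tab)
  ...   | yes fx≡c | _ = x∈W , fx≡c
  ...   | no  _    | ()

  fibre-mono : ∀ {c V W} → V ⊆ W → fibre c V ⊆ fibre c W
  fibre-mono V⊆W x∈fibre with ∈-fibre⁻ x∈fibre
  ... | x∈V , fx≡c = ∈-fibre⁺ (V⊆W x∈V) fx≡c

  InjectiveOn : Subset n → Set a
  InjectiveOn R = ∀ {u v} → u ∈ R → v ∈ R → f u ≡ f v → u ≡ v

  injectiveOn-extend : ∀ {R W w} → w ∈ W → R ⊆ W ─ fibre (f w) W → InjectiveOn R →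
                       R ∪ ⁅ w ⁆ ⊆ W × ∣ R ∣ < ∣ R ∪ ⁅ w ⁆ ∣ × InjectiveOn (R ∪ ⁅ w ⁆)
  injectiveOn-extend {R} {W} {w} w∈W R⊆ injective = R∪w⊆W , ∣R∣<∣R∪w∣ , injective′
    where
    fu≢fw : ∀ {u} → u ∈ R → f u ≢ f w
    fu≢fw u∈R fu≡fw = x∈p─q⇒x∉q W _ (R⊆ u∈R) (∈-fibre⁺ (p─q⊆p W _ (R⊆ u∈R)) fu≡fw)

    R∪w⊆W : R ∪ ⁅ w ⁆ ⊆ W
    R∪w⊆W x∈R∪w with x∈p∪q⁻ R ⁅ w ⁆ x∈R∪w
    ... | inj₁ x∈R = p─q⊆p W _ (R⊆ x∈R)
    ... | inj₂ x∈w rewrite x∈⁅y⁆⇒x≡y w x∈w = w∈W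

    ∣R∣<∣R∪w∣ : ∣ R ∣ < ∣ R ∪ ⁅ w ⁆ ∣
    ∣R∣<∣R∪w∣ = p⊂q⇒∣p∣<∣q∣ (p⊆p∪q ⁅ w ⁆ , w , x∈p∪q⁺ (inj₂ (x∈⁅x⁆ w)) , λ w∈R → fu≢fw w∈R refl)

    injective′ : InjectiveOn (R ∪ ⁅ w ⁆)
    injective′ u∈ v∈ fu≡fv with x∈p∪q⁻ R ⁅ w ⁆ u∈ | x∈p∪q⁻ R ⁅ w ⁆ v∈
    ... | inj₁ u∈R | inj₁ v∈R = injective u∈R v∈R fu≡fv
    ... | inj₁ u∈R | inj₂ v∈w rewrite x∈⁅y⁆⇒x≡y w v∈w = contradiction fu≡fv (fu≢fw u∈R)
    ... | inj₂ u∈w | inj₁ v∈R rewrite x∈⁅y⁆⇒x≡y w u∈w = contradiction (sym fu≡fv) (fu≢fw v∈R)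
    ... | inj₂ u∈w | inj₂ v∈w = trans (x∈⁅y⁆⇒x≡y w u∈w) (sym (x∈⁅y⁆⇒x≡y w v∈w))

  injectiveOn-or-largeFibre : ∀ q m (W : Subset n) → m * suc q ≤ ∣ W ∣ →
    (∃ λ R → R ⊆ W × m ≤ ∣ R ∣ × InjectiveOn R) ⊎ (∃ λ c → q < ∣ fibre c W ∣)
  injectiveOn-or-largeFibre q zero W _ = inj₁ (⊥ , ⊥⊆ , z≤n , λ u∈⊥ → contradiction u∈⊥ ∉⊥)
  injectiveOn-or-largeFibre q (suc m) W bound with ∣p∣>0⇒Nonempty (≤-trans (s≤s z≤n) bound)
  ... | w , w∈W with q <? ∣ fibre (f w) W ∣
  ...   | yes large = inj₂ (f w , large)
  ...   | no  small
    with injectiveOn-or-largeFibre q m (W ─ fibre (f w) W)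
           (∣p∣≥k+x∧∣q∣≤k⇒∣p─q∣≥x W (fibre (f w) W) (≤-trans (n≤1+n _) bound) (≮⇒≥ small))
  ...     | inj₂ (c , large) = inj₂ (c , ≤-trans large (p⊆q⇒∣p∣≤∣q∣ (fibre-mono (p─q⊆p W (fibre (f w) W)))))
  ...     | inj₁ (R , R⊆ , m≤∣R∣ , injective) with injectiveOn-extend w∈W R⊆ injective
  ...       | R∪w⊆W , ∣R∣<∣R∪w∣ , injective′ =
    inj₁ (R ∪ ⁅ w ⁆ , R∪w⊆W , ≤-trans (s≤s m≤∣R∣) ∣R∣<∣R∪w∣ , injective′)

-- Graphs and rooted forests

Adjacent : (G : Graph) → Fin (n G) → Fin (n G) → Set
Adjacent G u v = adj G u v ≡ true

Adjacent-sym : ∀ G {u v} → Adjacent G u v → Adjacent G v u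
Adjacent-sym G {u} {v} u~v = trans (Graph.sym G v u) u~v

Comparable : ∀ {n} → RootedForest n → Fin n → Fin n → Set
Comparable F u v = AncEq F u v ⊎ AncEq F v u

module Ancestry {n : ℕ} (F : RootedForest n) where

  0<depth : ∀ v → 0 < depth F v
  0<depth v with parent F v in eq
  ... | nothing = subst (0 <_) (sym (depth-root F v eq)) (s≤s z≤n)
  ... | just u  = subst (0 <_) (sym (depth-child F v u eq)) (s≤s z≤n)

  AncEq⇒depth≤ : ∀ {u v} → AncEq F u v → depth F u ≤ depth F v
  AncEq⇒depth≤ (anc-refl _) = ≤-refl
  AncEq⇒depth≤ (anc-step {w = w} v eq u≤w) =
    ≤-trans (AncEq⇒depth≤ u≤w) (≤-trans (n≤1+n _) (≤-reflexive (sym (depth-child F v w eq))))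

  AncEq-trans : ∀ {u v w} → AncEq F u v → AncEq F v w → AncEq F u w
  AncEq-trans u≤v (anc-refl _)        = u≤v
  AncEq-trans u≤v (anc-step w eq v≤p) = anc-step w eq (AncEq-trans u≤v v≤p)

  AncEq∧depth≡⇒≡ : ∀ {u v} → AncEq F u v → depth F u ≡ depth F v → u ≡ v
  AncEq∧depth≡⇒≡ (anc-refl _) _ = refl
  AncEq∧depth≡⇒≡ {u} (anc-step {w = w} v eq u≤w) du≡dv = contradiction du≡dv (<⇒≢ (begin-strict
    depth F u       ≤⟨ AncEq⇒depth≤ u≤w ⟩
    depth F w       <⟨ n<1+n _ ⟩
    suc (depth F w) ≡⟨ sym (depth-child F v w eq) ⟩
    depth F v       ∎))
    where open ≤-Reasoning

  AncEq∧≢⇒depth< : ∀ {u v} → AncEq F u v → u ≢ v → depth F u < depth F v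
  AncEq∧≢⇒depth< u≤v u≢v = ≤∧≢⇒< (AncEq⇒depth≤ u≤v) (λ du≡dv → u≢v (AncEq∧depth≡⇒≡ u≤v du≡dv))

  ancestors-comparable : ∀ {u v x} → AncEq F u x → AncEq F v x → Comparable F u v
  ancestors-comparable (anc-refl _) v≤x = inj₂ v≤x
  ancestors-comparable u≤x@(anc-step _ _ _) (anc-refl _) = inj₁ u≤x
  ancestors-comparable (anc-step x eq u≤p) (anc-step .x eq′ v≤p′) with trans (sym eq) eq′
  ... | refl = ancestors-comparable u≤p v≤p′

  ancestors-depth-injective : ∀ {u v x} → AncEq F u x → AncEq F v x → depth F u ≡ depth F v → u ≡ v
  ancestors-depth-injective u≤x v≤x du≡dv with ancestors-comparable u≤x v≤x
  ... | inj₁ u≤v = AncEq∧depth≡⇒≡ u≤v du≡dv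
  ... | inj₂ v≤u = sym (AncEq∧depth≡⇒≡ v≤u (sym du≡dv))

  ancestor : ℕ → Fin n → Fin n
  ancestor zero    x = x
  ancestor (suc k) x with parent F x
  ... | nothing = x
  ... | just p  = ancestor k p

  ancestor-AncEq : ∀ k x → AncEq F (ancestor k x) x
  ancestor-AncEq zero    x = anc-refl x
  ancestor-AncEq (suc k) x with parent F x in eq
  ... | nothing = anc-refl x
  ... | just p  = AncEq-trans (ancestor-AncEq k p) (anc-step x eq (anc-refl p))

  depth-ancestor : ∀ k x → k < depth F x → depth F (ancestor k x) ≡ depth F x ∸ k
  depth-ancestor zero    x _ = refl
  depth-ancestor (suc k) x k<d with parent F x in eq
  ... | nothing = contradiction (subst (suc k <_) (depth-root F x eq) k<d) (λ { (s≤s ()) })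
  ... | just p rewrite depth-child F x p eq = depth-ancestor k p (≤-pred k<d)

  ancestorAtDepth : ℕ → Fin n → Fin n
  ancestorAtDepth d x = ancestor (depth F x ∸ d) x

  ancestorAtDepth-AncEq : ∀ d x → AncEq F (ancestorAtDepth d x) x
  ancestorAtDepth-AncEq d x = ancestor-AncEq (depth F x ∸ d) x

  depth-ancestorAtDepth : ∀ d x → 0 < d → d ≤ depth F x → depth F (ancestorAtDepth d x) ≡ d
  depth-ancestorAtDepth d x 0<d d≤dx =
    trans (depth-ancestor (depth F x ∸ d) x (∸-monoʳ-< 0<d d≤dx)) (m∸[m∸n]≡n d≤dx)

-- Bounded treedepth implies flatness

EdgesComparable : (G : Graph) → RootedForest (n G) → Set
EdgesComparable G F = ∀ u v → Adjacent G u v → Comparable F u v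

Separated : (G : Graph) → Subset (n G) → Subset (n G) → Set
Separated G S W = ∀ {u v} → u ∈ W → v ∈ W → u ≢ v → ¬ SameComponent G S u v

DeletionWitness : (G : Graph) → ℕ → ℕ → Subset (n G) → Set
DeletionWitness G k m W =
  Σ (Subset (n G)) λ S → ∣ S ∣ ≤ k ×
    Σ (Subset (n G)) λ W⋆ →
      W⋆ ⊆ W × (∀ {v} → v ∈ W⋆ → v ∉ S) × ∣ W⋆ ∣ ≥ m × Separated G S W⋆

DeletionWitness-mono : ∀ {G k m V W} → V ⊆ W → DeletionWitness G k m V → DeletionWitness G k m W
DeletionWitness-mono V⊆W (S , ∣S∣≤k , W⋆ , W⋆⊆V , rest) = S , ∣S∣≤k , W⋆ , (λ x∈W⋆ → V⊆W (W⋆⊆V x∈W⋆)) , rest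

SameComponent⇒source∉ : ∀ {G S u v} → SameComponent G S u v → u ∉ S
SameComponent⇒source∉ (here u∉S)     = u∉S
SameComponent⇒source∉ (step u∉S _ _) = u∉S

flatnessBound : ℕ → ℕ → ℕ
flatnessBound m zero    = 1
flatnessBound m (suc t) = m * suc (flatnessBound m t)

module Forward (G : Graph) (F : RootedForest (n G)) (comparable : EdgesComparable G F) where
  open Ancestry F

  -- An edge leaving the subtree of c goes up to a strict ancestor of c, and those are all deleted.
  subtree-closed : ∀ {S c x y} → (∀ {z} → AncEq F z c → z ≢ c → z ∈ S) →
                   SameComponent G S x y → AncEq F c x → AncEq F c y
  subtree-closed deleted (here _) c≤x = c≤x
  subtree-closed {c = c} deleted (step {w = w} _ x~w w~y) c≤x with comparable _ _ x~w
  ... | inj₁ x≤w = subtree-closed deleted w~y (AncEq-trans c≤x x≤w)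
  ... | inj₂ w≤x with ancestors-comparable c≤x w≤x
  ...   | inj₁ c≤w = subtree-closed deleted w~y c≤w
  ...   | inj₂ w≤c with w ≟ c
  ...     | yes refl = subtree-closed deleted w~y w≤c
  ...     | no  w≢c  = contradiction (deleted w≤c w≢c) (SameComponent⇒source∉ w~y)

  ShallowAncestorsIn : Subset (n G) → ℕ → Subset (n G) → Set
  ShallowAncestorsIn S j W = ∀ {x} → x ∈ W → x ∉ S × (∀ {y} → AncEq F y x → depth F y ≤ j → y ∈ S)

  ShallowAncestorsIn⇒deep : ∀ {S j W x} → ShallowAncestorsIn S j W → x ∈ W → suc j ≤ depth F x
  ShallowAncestorsIn⇒deep {j = j} {x = x} shallow x∈W with depth F x ≤? j
  ... | yes dx≤j = contradiction (proj₂ (shallow x∈W) (anc-refl x) dx≤j) (proj₁ (shallow x∈W))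
  ... | no  dx≰j = ≰⇒> dx≰j

  branch : ℕ → Fin (n G) → Fin (n G)
  branch j = ancestorAtDepth (suc j)

  branch-AncEq : ∀ j x → AncEq F (branch j x) x
  branch-AncEq j = ancestorAtDepth-AncEq (suc j)

  depth-branch : ∀ {S j W x} → ShallowAncestorsIn S j W → x ∈ W → depth F (branch j x) ≡ suc j
  depth-branch shallow x∈W = depth-ancestorAtDepth _ _ (s≤s z≤n) (ShallowAncestorsIn⇒deep shallow x∈W)

  module Branches (j : ℕ) = Fibres _≟_ (branch j)

  distinct-branches-separated : ∀ {S j W R} → ShallowAncestorsIn S j W → R ⊆ W →
                                 Branches.InjectiveOn j R → Separated G S R
  distinct-branches-separated {S} {j} shallow R⊆W injective {u} {v} u∈R v∈R u≢v u~v =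
    u≢v (injective u∈R v∈R (ancestors-depth-injective c≤v (branch-AncEq j v) dc≡dc′))
    where
    c : Fin (n G)
    c = branch j u
    c≤u : AncEq F c u
    c≤u = branch-AncEq j u
    dc≡dc′ : depth F c ≡ depth F (branch j v)
    dc≡dc′ = trans (depth-branch shallow (R⊆W u∈R)) (sym (depth-branch shallow (R⊆W v∈R)))
    strict-ancestors-deleted : ∀ {z} → AncEq F z c → z ≢ c → z ∈ S
    strict-ancestors-deleted z≤c z≢c = proj₂ (shallow (R⊆W u∈R)) (AncEq-trans z≤c c≤u)
      (≤-pred (subst (depth F _ <_) (depth-branch shallow (R⊆W u∈R)) (AncEq∧≢⇒depth< z≤c z≢c)))
    c≤v : AncEq F c v
    c≤v = subtree-closed strict-ancestors-deleted u~v c≤u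

  descend-into-fibre : ∀ {S j W c} → ShallowAncestorsIn S j W →
                       ShallowAncestorsIn (S ∪ ⁅ c ⁆) (suc j) (Branches.fibre j c W - c)
  descend-into-fibre {S} {j} {W} {c} shallow {y} y∈W′ = y∉S∪c , deleted
    where
    y∈W×branch≡c : y ∈ W × branch j y ≡ c
    y∈W×branch≡c = Branches.∈-fibre⁻ j (p─q⊆p _ ⁅ c ⁆ y∈W′)
    y∈W : y ∈ W
    y∈W = proj₁ y∈W×branch≡c
    c≤y : AncEq F c y
    c≤y = subst (λ z → AncEq F z y) (proj₂ y∈W×branch≡c) (branch-AncEq j y)
    dc≡1+j : depth F c ≡ suc j
    dc≡1+j = subst (λ z → depth F z ≡ suc j) (proj₂ y∈W×branch≡c) (depth-branch shallow y∈W)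
    y∉S∪c : y ∉ S ∪ ⁅ c ⁆
    y∉S∪c y∈S∪c with x∈p∪q⁻ S ⁅ c ⁆ y∈S∪c
    ... | inj₁ y∈S = proj₁ (shallow y∈W) y∈S
    ... | inj₂ y∈c = x∈p─q⇒x∉q _ ⁅ c ⁆ y∈W′ y∈c
    deleted : ∀ {z} → AncEq F z y → depth F z ≤ suc j → z ∈ S ∪ ⁅ c ⁆
    deleted {z} z≤y dz≤1+j with depth F z ≤? j
    ... | yes dz≤j = x∈p∪q⁺ (inj₁ (proj₂ (shallow y∈W) z≤y dz≤j))
    ... | no  dz≰j rewrite ancestors-depth-injective z≤y c≤y (trans (≤-antisym dz≤1+j (≰⇒> dz≰j)) (sym dc≡1+j))
                 = x∈p∪q⁺ (inj₂ (x∈⁅x⁆ c))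

  module _ (m d : ℕ) (depth≤d : ∀ v → depth F v ≤ d) where

    separate : ∀ t {S j W} → j + t ≡ d → ∣ S ∣ ≤ j → flatnessBound m t ≤ ∣ W ∣ →
               ShallowAncestorsIn S j W → DeletionWitness G d m W
    separate zero {j = j} j+0≡d _ 1≤∣W∣ shallow with ∣p∣>0⇒Nonempty 1≤∣W∣
    ... | x , x∈W = contradiction (≤-trans (depth≤d x) (≤-reflexive (trans (sym j+0≡d) (+-identityʳ j))))
                                  (<⇒≱ (ShallowAncestorsIn⇒deep shallow x∈W))
    separate (suc t) {S} {j} {W} j+1+t≡d ∣S∣≤j bound shallow
      with Branches.injectiveOn-or-largeFibre j (flatnessBound m t) m W bound
    ... | inj₁ (R , R⊆W , m≤∣R∣ , injective) =
      S , ≤-trans ∣S∣≤j (subst (j ≤_) j+1+t≡d (m≤m+n j (suc t))) ,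
      R , R⊆W , (λ v∈R → proj₁ (shallow (R⊆W v∈R))) , m≤∣R∣ , distinct-branches-separated shallow R⊆W injective
    ... | inj₂ (c , large) =
      DeletionWitness-mono (λ y∈W′ → proj₁ (Branches.∈-fibre⁻ j (p─q⊆p _ ⁅ c ⁆ y∈W′)))
        (separate t (trans (sym (+-suc j t)) j+1+t≡d) ∣S∪c∣≤1+j bound′ (descend-into-fibre {c = c} shallow))
      where
      ∣S∪c∣≤1+j : ∣ S ∪ ⁅ c ⁆ ∣ ≤ suc j
      ∣S∪c∣≤1+j = ≤-trans (∣p∪⁅x⁆∣≤1+∣p∣ S c) (s≤s ∣S∣≤j)
      bound′ : flatnessBound m t ≤ ∣ Branches.fibre j c W - c ∣
      bound′ = ≤-pred (≤-trans large (∣p∣≤1+∣p-x∣ (Branches.fibre j c W) c))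

boundedTreedepth⇒flat : ∀ {G d} → TreedepthAtMost G d → ∀ m W → flatnessBound m d ≤ ∣ W ∣ → DeletionWitness G d m W
boundedTreedepth⇒flat {G} {d} (F , depth≤d , comparable) m W bound =
  separate m d depth≤d d refl (≤-reflexive (∣⊥∣≡0 (n G))) bound
    (λ _ → ∉⊥ , λ {y} _ dy≤0 → contradiction dy≤0 (<⇒≱ (0<depth y)))
  where
  open Forward G F comparable
  open Ancestry F

-- Long paths are not flat

IsPath : (G : Graph) → List (Fin (n G)) → Set
IsPath G xs = Unique xs × Linked (Adjacent G) xs

SameComponent-snoc : ∀ {G S y u v} → SameComponent G S y u → Adjacent G u v → v ∉ S → SameComponent G S y v
SameComponent-snoc (here y∉S)         u~v v∉S = step y∉S u~v (here v∉S)
SameComponent-snoc (step y∉S y~w w~u) u~v v∉S = step y∉S y~w (SameComponent-snoc w~u u~v v∉S)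

module _ {n : ℕ} where

  countIn : Subset n → List (Fin n) → ℕ
  countIn A []       = 0
  countIn A (x ∷ xs) with x ∈? A
  ... | yes _ = suc (countIn A xs)
  ... | no  _ = countIn A xs

  fromList : List (Fin n) → Subset n
  fromList []       = ⊥
  fromList (x ∷ xs) = ⁅ x ⁆ ∪ fromList xs

  countIn-mono : ∀ {A B xs} → All (λ y → y ∈ A → y ∈ B) xs → countIn A xs ≤ countIn B xs
  countIn-mono [] = z≤n
  countIn-mono {A} {B} {x ∷ xs} (A⇒B ∷ rest) with x ∈? A | x ∈? B
  ... | yes _   | yes _   = s≤s (countIn-mono rest)
  ... | yes x∈A | no  x∉B = contradiction (A⇒B x∈A) x∉B
  ... | no  _   | yes _   = m≤n⇒m≤1+n (countIn-mono rest)
  ... | no  _   | no  _   = countIn-mono rest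

  length≤countIn : ∀ {A xs} → All (_∈ A) xs → length xs ≤ countIn A xs
  length≤countIn [] = z≤n
  length≤countIn {A} {x ∷ xs} (x∈A ∷ rest) with x ∈? A
  ... | yes _   = s≤s (length≤countIn rest)
  ... | no  x∉A = contradiction x∈A x∉A

  countIn≤∣∣ : ∀ {A xs} → Unique xs → countIn A xs ≤ ∣ A ∣
  countIn≤∣∣ [] = z≤n
  countIn≤∣∣ {A} {x ∷ xs} (x∉xs ∷ unique) with x ∈? A
  ... | no  _   = countIn≤∣∣ unique
  ... | yes x∈A = begin
    suc (countIn A xs)       ≤⟨ s≤s (countIn-mono (All.map (λ y≢x y∈A → x∈p∧x≢y⇒x∈p-y y∈A (y≢x ∘ sym)) x∉xs)) ⟩
    suc (countIn (A - x) xs) ≤⟨ s≤s (countIn≤∣∣ unique) ⟩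
    suc ∣ A - x ∣            ≤⟨ x∈p⇒∣p-x∣<∣p∣ x∈A ⟩
    ∣ A ∣                    ∎
    where open ≤-Reasoning

  ∈-fromList : ∀ xs → All (_∈ fromList xs) xs
  ∈-fromList []       = []
  ∈-fromList (x ∷ xs) = x∈p∪q⁺ (inj₁ (x∈⁅x⁆ x)) ∷ All.map (λ y∈xs → x∈p∪q⁺ (inj₂ y∈xs)) (∈-fromList xs)

  ∣∣≤countIn : ∀ {A} xs → A ⊆ fromList xs → ∣ A ∣ ≤ countIn A xs
  ∣∣≤countIn {A} [] A⊆∅ = ≤-trans (p⊆q⇒∣p∣≤∣q∣ A⊆∅) (≤-reflexive (∣⊥∣≡0 n))
  ∣∣≤countIn {A} (x ∷ xs) A⊆x∷xs with x ∈? A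
  ... | no x∉A = ∣∣≤countIn xs (λ y∈A → in-tail y∈A (λ { refl → x∉A y∈A }))
    where
    in-tail : ∀ {y} → y ∈ A → y ≢ x → y ∈ fromList xs
    in-tail y∈A y≢x with x∈p∪q⁻ ⁅ x ⁆ (fromList xs) (A⊆x∷xs y∈A)
    ... | inj₁ y∈x  = contradiction (x∈⁅y⁆⇒x≡y x y∈x) y≢x
    ... | inj₂ y∈xs = y∈xs
  ... | yes _ = begin
    ∣ A ∣                    ≤⟨ ∣p∣≤1+∣p-x∣ A x ⟩
    suc ∣ A - x ∣            ≤⟨ s≤s (∣∣≤countIn xs A-x⊆xs) ⟩
    suc (countIn (A - x) xs) ≤⟨ s≤s (countIn-mono (All.universal (λ _ → p─q⊆p A ⁅ x ⁆) xs)) ⟩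
    suc (countIn A xs)       ∎
    where
    open ≤-Reasoning
    A-x⊆xs : A - x ⊆ fromList xs
    A-x⊆xs y∈A-x with x∈p∪q⁻ ⁅ x ⁆ (fromList xs) (A⊆x∷xs (p─q⊆p A ⁅ x ⁆ y∈A-x))
    ... | inj₁ y∈x  = contradiction y∈x (x∈p─q⇒x∉q A ⁅ x ⁆ y∈A-x)
    ... | inj₂ y∈xs = y∈xs

  length≤∣fromList∣ : ∀ {xs} → Unique xs → length xs ≤ ∣ fromList xs ∣
  length≤∣fromList∣ {xs} unique = ≤-trans (length≤countIn (∈-fromList xs)) (countIn≤∣∣ unique)

  unique⇒length≤n : ∀ {xs} → Unique xs → length xs ≤ n
  unique⇒length≤n {xs} unique =
    ≤-trans (length≤countIn (All.universal (λ _ → ∈⊤) xs)) (≤-trans (countIn≤∣∣ unique) (≤-reflexive (∣⊤∣≡n n)))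

module PathSeparation (G : Graph) (S W⋆ : Subset (n G)) (disjoint : ∀ {v} → v ∈ W⋆ → v ∉ S)
                      (separated : Separated G S W⋆) where

  -- The W⋆-vertex, if any, whose component in G - S the path is still traversing.
  data Open (xs : List (Fin (n G))) : Set where
    none : Open xs
    some : ∀ {y u} → y ∈ W⋆ → All (y ≢_) xs → SameComponent G S y u → Linked (Adjacent G) (u ∷ xs) → Open xs

  weight : ∀ {xs} → Open xs → ℕ
  weight none           = 0
  weight (some _ _ _ _) = 1

  weight≤1 : ∀ {xs} (o : Open xs) → weight o ≤ 1
  weight≤1 none           = z≤n
  weight≤1 (some _ _ _ _) = ≤-refl

  countIn-separated : ∀ {xs} → IsPath G xs → (o : Open xs) → weight o + countIn W⋆ xs ≤ suc (countIn S xs)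
  countIn-separated {[]} _ o = ≤-trans (≤-reflexive (+-identityʳ (weight o))) (weight≤1 o)
  countIn-separated {x ∷ xs} (x∉xs ∷ unique , linked) o with x ∈? S | x ∈? W⋆
  ... | yes x∈S | yes x∈W⋆ = contradiction x∈S (disjoint x∈W⋆)
  ... | yes _   | no  _    = ≤-trans (+-monoˡ-≤ (countIn W⋆ xs) (weight≤1 o))
                                     (s≤s (countIn-separated (unique , Linked-tail linked) none))
  ... | no  x∉S | yes x∈W⋆ with o
  ...   | none = countIn-separated (unique , Linked-tail linked) (some x∈W⋆ x∉xs (here x∉S) linked)
  ...   | some y∈W⋆ (y≢x ∷ _) y~u (u~x ∷ _) = contradiction (SameComponent-snoc y~u u~x x∉S) (separated y∈W⋆ x∈W⋆ y≢x)
  countIn-separated {x ∷ xs} (x∉xs ∷ unique , linked) o | no x∉S | no _ with o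
  ...   | none = countIn-separated (unique , Linked-tail linked) none
  ...   | some y∈W⋆ (_ ∷ y∉xs) y~u (u~x ∷ _) =
    countIn-separated (unique , Linked-tail linked) (some y∈W⋆ y∉xs (SameComponent-snoc y~u u~x x∉S) linked)

  ∣W⋆∣≤1+∣S∣ : ∀ {xs} → IsPath G xs → W⋆ ⊆ fromList xs → ∣ W⋆ ∣ ≤ suc ∣ S ∣
  ∣W⋆∣≤1+∣S∣ {xs} path@(unique , _) W⋆⊆xs = begin
    ∣ W⋆ ∣             ≤⟨ ∣∣≤countIn xs W⋆⊆xs ⟩
    countIn W⋆ xs      ≤⟨ countIn-separated path none ⟩
    suc (countIn S xs) ≤⟨ s≤s (countIn≤∣∣ unique) ⟩
    suc ∣ S ∣          ∎
    where open ≤-Reasoning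

flat⇒paths-shorter : ∀ {G N k} → (∀ W → N ≤ ∣ W ∣ → DeletionWitness G k (2 + k) W) →
                     ∀ {xs} → IsPath G xs → length xs < N
flat⇒paths-shorter {G} {N} {k} flat {xs} path with length xs <? N
... | yes shorter = shorter
... | no  longer with flat (fromList xs) (≤-trans (≮⇒≥ longer) (length≤∣fromList∣ (proj₁ path)))
...   | S , ∣S∣≤k , W⋆ , W⋆⊆xs , disjoint , 2+k≤∣W⋆∣ , separated =
  contradiction (≤-trans 2+k≤∣W⋆∣ (∣W⋆∣≤1+∣S∣ path W⋆⊆xs)) (<⇒≱ (s≤s (s≤s ∣S∣≤k)))
  where open PathSeparation G S W⋆ disjoint separated

-- Depth-first search

ParentsAdjacent : (G : Graph) → RootedForest (n G) → Set
ParentsAdjacent G F = ∀ {v u} → parent F v ≡ just u → Adjacent G u v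

module RootPaths (G : Graph) (F : RootedForest (n G)) (parents-adjacent : ParentsAdjacent G F) where
  open Ancestry F

  rootPath : ∀ k v → depth F v ≡ suc k →
             Σ (List (Fin (n G))) λ ys → length ys ≡ k × IsPath G (v ∷ ys) × All (λ y → depth F y < depth F v) ys
  rootPath zero v _ = [] , refl , ([] ∷ [] , [-]) , []
  rootPath (suc k) v dv≡2+k with parent F v in eq
  ... | nothing = contradiction (trans (sym (depth-root F v eq)) dv≡2+k) (λ ())
  ... | just u with rootPath k u (suc-injective (trans (sym (depth-child F v u eq)) dv≡2+k))
  ...   | ys , length≡k , (unique , linked) , below-u =
    u ∷ ys , cong suc length≡k , (All.map v≢ below-v ∷ unique , Adjacent-sym G (parents-adjacent eq) ∷ linked) , below-v
    where
    du<dv : depth F u < depth F v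
    du<dv = subst (depth F u <_) (sym (depth-child F v u eq)) ≤-refl
    below-v : All (λ y → depth F y < depth F v) (u ∷ ys)
    below-v = du<dv ∷ All.map (λ dy<du → <-trans dy<du du<dv) below-u
    v≢ : ∀ {y} → depth F y < depth F v → v ≢ y
    v≢ dy<dv refl = <-irrefl refl dy<dv

  depth-realised-by-path : ∀ v → Σ (List (Fin (n G))) λ xs → IsPath G xs × depth F v ≡ length xs
  depth-realised-by-path v with depth F v in dv | 0<depth v
  ... | suc k | _ with rootPath k v dv
  ...   | ys , length≡k , path , _ = v ∷ ys , path , cong suc (sym length≡k)

  depth≤n : ∀ v → depth F v ≤ n G
  depth≤n v with depth-realised-by-path v
  ... | xs , (unique , _) , dv≡length = ≤-trans (≤-reflexive dv≡length) (unique⇒length≤n unique)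

depthBelow : ∀ {n} → RootedForest n → Maybe (Fin n) → ℕ
depthBelow F nothing  = 1
depthBelow F (just x) = suc (depth F x)

graft : ∀ {n} (F : RootedForest n) (w : Fin n) (p : Maybe (Fin n)) →
        p ≢ just w → (∀ {v} → parent F v ≢ just w) → RootedForest n
graft F w p p≢w childless = record
  { parent      = parent′
  ; depth       = depth′
  ; depth-root  = depth-root′
  ; depth-child = depth-child′
  }
  where
  parent′ : Fin _ → Maybe (Fin _)
  parent′ = updateAt (parent F) w (const p)
  depth′ : Fin _ → ℕ
  depth′ = updateAt (depth F) w (const (depthBelow F p))

  depth-root′ : ∀ v → parent′ v ≡ nothing → depth′ v ≡ 1
  depth-root′ v eq with v ≟ w
  ... | no v≢w = trans (updateAt-minimal v w (depth F) v≢w)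
                       (depth-root F v (trans (sym (updateAt-minimal v w (parent F) v≢w)) eq))
  ... | yes refl with trans (sym (updateAt-updates w (parent F))) eq
  ...   | refl = updateAt-updates w (depth F)

  depth-child′ : ∀ v u → parent′ v ≡ just u → depth′ v ≡ suc (depth′ u)
  depth-child′ v u eq with v ≟ w | u ≟ w
  ... | yes refl | yes refl = contradiction (trans (sym (updateAt-updates w (parent F))) eq) p≢w
  ... | no v≢w   | yes refl = contradiction (trans (sym (updateAt-minimal v w (parent F) v≢w)) eq) childless
  ... | yes refl | no u≢w with trans (sym (updateAt-updates w (parent F))) eq
  ...   | refl = trans (updateAt-updates w (depth F)) (cong suc (sym (updateAt-minimal u w (depth F) u≢w)))
  depth-child′ v u eq | no v≢w | no u≢w = begin
    depth′ v          ≡⟨ updateAt-minimal v w (depth F) v≢w ⟩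
    depth F v         ≡⟨ depth-child F v u (trans (sym (updateAt-minimal v w (parent F) v≢w)) eq) ⟩
    suc (depth F u)   ≡⟨ cong suc (sym (updateAt-minimal u w (depth F) u≢w)) ⟩
    suc (depth′ u)    ∎
    where open ≡-Reasoning

module Trémaux (G : Graph) where

  record State : Set where
    constructor ⟨_,_⟩
    field
      visited : Subset (n G)
      forest  : RootedForest (n G)
  open State

  record Invariant (st : State) (OnStack : Fin (n G) → Set) : Set where
    field
      parents-adjacent   : ParentsAdjacent G (forest st)
      parents-visited    : ∀ {v u} → parent (forest st) v ≡ just u → u ∈ visited st
      unvisited-roots    : ∀ {v} → v ∉ visited st → parent (forest st) v ≡ nothing
      frontier-on-stack  : ∀ {y z} → y ∈ visited st → Adjacent G y z → z ∉ visited st → OnStack y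
      visited-comparable : ∀ {y z} → y ∈ visited st → z ∈ visited st → Adjacent G y z → Comparable (forest st) y z
  open Invariant

  record _⊑_ (s t : State) : Set where
    field
      visited-⊆   : visited s ⊆ visited t
      parent-kept : ∀ {v} → v ∈ visited s → parent (forest t) v ≡ parent (forest s) v
      depth-kept  : ∀ {v} → v ∈ visited s → depth (forest t) v ≡ depth (forest s) v
  open _⊑_

  ⊑-refl : ∀ {s} → s ⊑ s
  ⊑-refl = record { visited-⊆ = λ v∈ → v∈ ; parent-kept = λ _ → refl ; depth-kept = λ _ → refl }

  ⊑-trans : ∀ {s t u} → s ⊑ t → t ⊑ u → s ⊑ u
  ⊑-trans s⊑t t⊑u = record
    { visited-⊆   = visited-⊆ t⊑u ∘ visited-⊆ s⊑t
    ; parent-kept = λ v∈ → trans (parent-kept t⊑u (visited-⊆ s⊑t v∈)) (parent-kept s⊑t v∈)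
    ; depth-kept  = λ v∈ → trans (depth-kept t⊑u (visited-⊆ s⊑t v∈)) (depth-kept s⊑t v∈)
    }

  AncEq-⊑ : ∀ {s t P u v} → Invariant s P → s ⊑ t → v ∈ visited s → AncEq (forest s) u v → AncEq (forest t) u v
  AncEq-⊑ inv s⊑t v∈ (anc-refl _)          = anc-refl _
  AncEq-⊑ inv s⊑t v∈ (anc-step v eq u≤w) =
    anc-step v (trans (parent-kept s⊑t v∈) eq) (AncEq-⊑ inv s⊑t (parents-visited inv eq) u≤w)

  Push : (Fin (n G) → Set) → Fin (n G) → Fin (n G) → Set
  Push Q x y = Q y ⊎ y ≡ x

  module Mark {P : Fin (n G) → Set} (st : State) (inv : Invariant st P) (w : Fin (n G)) (w∉ : w ∉ visited st)
              (p : Maybe (Fin (n G))) (p-ok : ∀ {x} → p ≡ just x → x ∈ visited st × Adjacent G x w) where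

    forest′ : RootedForest (n G)
    forest′ = graft (forest st) w p (λ p≡w → w∉ (proj₁ (p-ok p≡w))) (λ eq → w∉ (parents-visited inv eq))

    next : State
    next = ⟨ visited st ∪ ⁅ w ⁆ , forest′ ⟩

    w∈next : w ∈ visited next
    w∈next = x∈p∪q⁺ (inj₂ (x∈⁅x⁆ w))

    parent-w : parent forest′ w ≡ p
    parent-w = updateAt-updates w (parent (forest st))

    depth-w : depth forest′ w ≡ depthBelow (forest st) p
    depth-w = updateAt-updates w (depth (forest st))

    parent-unchanged : ∀ {v} → v ≢ w → parent forest′ v ≡ parent (forest st) v
    parent-unchanged {v} = updateAt-minimal v w (parent (forest st))

    st⊑next : st ⊑ next
    st⊑next = record
      { visited-⊆   = λ v∈ → x∈p∪q⁺ (inj₁ v∈)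
      ; parent-kept = λ v∈ → parent-unchanged (λ { refl → w∉ v∈ })
      ; depth-kept  = λ {v} v∈ → updateAt-minimal v w (depth (forest st)) (λ { refl → w∉ v∈ })
      }

    visited-next⁻ : ∀ {v} → v ∈ visited next → v ∈ visited st ⊎ v ≡ w
    visited-next⁻ v∈ with x∈p∪q⁻ (visited st) ⁅ w ⁆ v∈
    ... | inj₁ v∈st = inj₁ v∈st
    ... | inj₂ v∈w  = inj₂ (x∈⁅y⁆⇒x≡y w v∈w)

    -- An older visited neighbour of w lay on the frontier, hence on the stack, hence above w.
    invariant : (∀ {z} → P z → AncEq forest′ z w) → Invariant next (Push P w)
    invariant stack-above-w = record
      { parents-adjacent   = adjacent′
      ; parents-visited    = visited′
      ; unvisited-roots    = λ {v} v∉ → trans (parent-unchanged (λ { refl → v∉ w∈next }))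
                                              (unvisited-roots inv (v∉ ∘ visited-⊆ st⊑next))
      ; frontier-on-stack  = frontier′
      ; visited-comparable = comparable′
      }
      where
      adjacent′ : ParentsAdjacent G forest′
      adjacent′ {v} eq with v ≟ w
      ... | yes refl = proj₂ (p-ok (trans (sym parent-w) eq))
      ... | no  v≢w  = parents-adjacent inv (trans (sym (parent-unchanged v≢w)) eq)

      visited′ : ∀ {v u} → parent forest′ v ≡ just u → u ∈ visited next
      visited′ {v} eq with v ≟ w
      ... | yes refl = visited-⊆ st⊑next (proj₁ (p-ok (trans (sym parent-w) eq)))
      ... | no  v≢w  = visited-⊆ st⊑next (parents-visited inv (trans (sym (parent-unchanged v≢w)) eq))

      frontier′ : ∀ {y z} → y ∈ visited next → Adjacent G y z → z ∉ visited next → Push P w y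
      frontier′ y∈ y~z z∉ with visited-next⁻ y∈
      ... | inj₁ y∈st = inj₁ (frontier-on-stack inv y∈st y~z (z∉ ∘ visited-⊆ st⊑next))
      ... | inj₂ y≡w  = inj₂ y≡w

      comparable′ : ∀ {y z} → y ∈ visited next → z ∈ visited next → Adjacent G y z → Comparable forest′ y z
      comparable′ y∈ z∈ y~z with visited-next⁻ y∈ | visited-next⁻ z∈
      ... | inj₂ refl | inj₂ refl = contradiction (trans (sym y~z) (irrefl G w)) λ ()
      ... | inj₂ refl | inj₁ z∈st = inj₂ (stack-above-w (frontier-on-stack inv z∈st (Adjacent-sym G y~z) w∉))
      ... | inj₁ y∈st | inj₂ refl = inj₁ (stack-above-w (frontier-on-stack inv y∈st y~z w∉))
      ... | inj₁ y∈st | inj₁ z∈st with visited-comparable inv y∈st z∈st y~z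
      ...   | inj₁ y≤z = inj₁ (AncEq-⊑ inv st⊑next z∈st y≤z)
      ...   | inj₂ z≤y = inj₂ (AncEq-⊑ inv st⊑next y∈st z≤y)

  Covers : (Fin (n G) → Set) → List (Fin (n G)) → Subset (n G) → Set
  Covers P ws V = ∀ {z} → P z → z ∈ₗ ws ⊎ z ∈ V

  Covers-tail : ∀ {P w ws V V′} → V ⊆ V′ → (P w → w ∈ V′) → Covers P (w ∷ ws) V → Covers P ws V′
  Covers-tail V⊆V′ w-done covers Pz with covers Pz
  ... | inj₁ (here refl)  = inj₂ (w-done Pz)
  ... | inj₁ (there z∈ws) = inj₁ z∈ws
  ... | inj₂ z∈V          = inj₂ (V⊆V′ z∈V)

  Covers-[] : ∀ {P V} → Covers P [] V → ∀ {z} → P z → z ∈ V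
  Covers-[] covers Pz = [ (λ ()) , id ]′ (covers Pz)

  pop : ∀ {st Q x} → Invariant st (Push Q x) → (∀ {z} → Adjacent G x z → z ∈ visited st) → Invariant st Q
  pop {st} {Q} inv neighbours-visited = record
    { parents-adjacent   = parents-adjacent inv
    ; parents-visited    = parents-visited inv
    ; unvisited-roots    = unvisited-roots inv
    ; frontier-on-stack  = frontier′
    ; visited-comparable = visited-comparable inv
    }
    where
    frontier′ : ∀ {y z} → y ∈ visited st → Adjacent G y z → z ∉ visited st → Q y
    frontier′ y∈ y~z z∉ with frontier-on-stack inv y∈ y~z z∉
    ... | inj₁ Qy   = Qy
    ... | inj₂ refl = contradiction (neighbours-visited y~z) z∉

  -- Each nested visit goes one level deeper, and no forest with adjacent parents is deeper than n G: so fuel n G suffices.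
  mutual
    visit : ∀ f {Q} x st → x ∈ visited st → (∀ {y} → Q y → AncEq (forest st) y x) →
            Invariant st (Push Q x) → n G < depth (forest st) x + f →
            Σ State λ st′ → st ⊑ st′ × Invariant st′ Q
    visit zero x st _ _ inv fuel =
      contradiction (subst (n G <_) (+-identityʳ _) fuel) (≤⇒≯ (RootPaths.depth≤n G (forest st) (parents-adjacent inv) x))
    visit (suc f) {Q} x st x∈ below inv fuel
      with scan f x (allFin (n G)) st x∈ below inv fuel (λ {z} _ → inj₁ (∈-allFin z))
    ... | st′ , st⊑st′ , inv′ , neighbours-visited = st′ , st⊑st′ , pop inv′ neighbours-visited

    scan : ∀ f {Q} x ws st → x ∈ visited st → (∀ {y} → Q y → AncEq (forest st) y x) →
           Invariant st (Push Q x) → n G < depth (forest st) x + suc f → Covers (Adjacent G x) ws (visited st) →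
           Σ State λ st′ → st ⊑ st′ × Invariant st′ (Push Q x) × (∀ {z} → Adjacent G x z → z ∈ visited st′)
    scan f x [] st _ _ inv _ covers = st , ⊑-refl , inv , Covers-[] covers
    scan f x (w ∷ ws) st x∈ below inv fuel covers with w ∈? visited st | adj G x w in x~w
    ... | yes w∈ | _     = scan f x ws st x∈ below inv fuel (Covers-tail id (λ _ → w∈) covers)
    ... | no  _  | false =
      scan f x ws st x∈ below inv fuel (Covers-tail id (λ x~w′ → contradiction (trans (sym x~w′) x~w) λ ()) covers)
    ... | no  w∉ | true with visit-child f x w st x∈ below inv fuel w∉ x~w
    ...   | st₂ , st⊑st₂ , inv₂ , w∈st₂
      with scan f x ws st₂ (visited-⊆ st⊑st₂ x∈) (AncEq-⊑ inv st⊑st₂ x∈ ∘ below) inv₂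
                (subst (λ d → n G < d + suc f) (sym (depth-kept st⊑st₂ x∈)) fuel)
                (Covers-tail (visited-⊆ st⊑st₂) (λ _ → w∈st₂) covers)
    ...     | st₃ , st₂⊑st₃ , inv₃ , done = st₃ , ⊑-trans st⊑st₂ st₂⊑st₃ , inv₃ , done

    visit-child : ∀ f {Q} x w st → x ∈ visited st → (∀ {y} → Q y → AncEq (forest st) y x) →
                  Invariant st (Push Q x) → n G < depth (forest st) x + suc f → w ∉ visited st → Adjacent G x w →
                  Σ State λ st′ → st ⊑ st′ × Invariant st′ (Push Q x) × w ∈ visited st′
    visit-child f {Q} x w st x∈ below inv fuel w∉ x~w =
      let st′ , next⊑st′ , inv′ = visit f w M.next M.w∈next below-w (M.invariant below-w) fuel-w
      in  st′ , ⊑-trans M.st⊑next next⊑st′ , inv′ , visited-⊆ next⊑st′ M.w∈next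
      where
      parent-ok : ∀ {y} → just x ≡ just y → y ∈ visited st × Adjacent G y w
      parent-ok refl = x∈ , x~w
      module M = Mark st inv w w∉ (just x) parent-ok
      below-w : ∀ {y} → Push Q x y → AncEq M.forest′ y w
      below-w (inj₁ Qy)   = anc-step w M.parent-w (AncEq-⊑ inv M.st⊑next x∈ (below Qy))
      below-w (inj₂ refl) = anc-step w M.parent-w (anc-refl _)
      fuel-w : n G < depth M.forest′ w + f
      fuel-w = subst (λ d → n G < d + f) (sym M.depth-w) (subst (n G <_) (+-suc _ f) fuel)

  Never : Fin (n G) → Set
  Never _ = Empty

  plant : ∀ w st → Invariant st Never → w ∉ visited st →
          Σ State λ st′ → st ⊑ st′ × Invariant st′ Never × w ∈ visited st′
  plant w st inv w∉ =
    let st′ , next⊑st′ , inv′ = visit (n G) w M.next M.w∈next (λ ()) (M.invariant (λ ())) fuel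
    in  st′ , ⊑-trans M.st⊑next next⊑st′ , inv′ , visited-⊆ next⊑st′ M.w∈next
    where
    no-parent : ∀ {y} → nothing ≡ just y → y ∈ visited st × Adjacent G y w
    no-parent ()
    module M = Mark st inv w w∉ nothing no-parent
    fuel : n G < depth M.forest′ w + n G
    fuel = subst (λ d → n G < d + n G) (sym M.depth-w) ≤-refl

  plant-all : ∀ ws st → Invariant st Never → Covers (const Unit) ws (visited st) →
              Σ State λ st′ → Invariant st′ Never × (∀ z → z ∈ visited st′)
  plant-all [] st inv covers = st , inv , λ z → Covers-[] covers tt
  plant-all (w ∷ ws) st inv covers with w ∈? visited st
  ... | yes w∈ = plant-all ws st inv (Covers-tail id (λ _ → w∈) covers)
  ... | no  w∉ with plant w st inv w∉
  ...   | st′ , st⊑st′ , inv′ , w∈st′ = plant-all ws st′ inv′ (Covers-tail (visited-⊆ st⊑st′) (λ _ → w∈st′) covers)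

  initial : State
  initial = ⟨ ⊥ , record { parent = λ _ → nothing ; depth = λ _ → 1 ; depth-root = λ _ _ → refl ; depth-child = λ _ _ () } ⟩

  initial-invariant : Invariant initial Never
  initial-invariant = record
    { parents-adjacent   = λ ()
    ; parents-visited    = λ ()
    ; unvisited-roots    = λ _ → refl
    ; frontier-on-stack  = λ y∈⊥ → contradiction y∈⊥ ∉⊥
    ; visited-comparable = λ y∈⊥ → contradiction y∈⊥ ∉⊥
    }

  trémaux-forest : Σ (RootedForest (n G)) λ F → ParentsAdjacent G F × EdgesComparable G F
  trémaux-forest with plant-all (allFin (n G)) initial initial-invariant (λ {z} _ → inj₁ (∈-allFin z))
  ... | st , inv , all-visited =
    forest st , parents-adjacent inv , λ u v u~v → visited-comparable inv (all-visited u) (all-visited v) u~v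

short-paths⇒treedepth : ∀ {G L} → (∀ {xs} → IsPath G xs → length xs ≤ L) → TreedepthAtMost G L
short-paths⇒treedepth {G} {L} short with Trémaux.trémaux-forest G
... | F , parents-adjacent , comparable = F , depth≤L , comparable
  where
  depth≤L : ∀ v → depth F v ≤ L
  depth≤L v with RootPaths.depth-realised-by-path G F parents-adjacent v
  ... | xs , path , dv≡length = ≤-trans (≤-reflexive dv≡length) (short path)

theorem18p27 : (C : GraphClass) → BoundedTreedepth C ⇔ DistInfDeletionFlat C
theorem18p27 C = mk⇔ bounded⇒flat flat⇒bounded
  where
  bounded⇒flat : BoundedTreedepth C → DistInfDeletionFlat C
  bounded⇒flat (d , bounded) = (λ m → flatnessBound m d) , d , λ m G G∈C → boundedTreedepth⇒flat (bounded G G∈C) m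
  flat⇒bounded : DistInfDeletionFlat C → BoundedTreedepth C
  flat⇒bounded (N , k , flat) = N (2 + k) , λ G G∈C →
    short-paths⇒treedepth {G} (λ path → <⇒≤ (flat⇒paths-shorter (flat (2 + k) G G∈C) path))
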